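{- Let $A$ be a chromotopology and $v$ a vertex of $A$. There exists a poset $P_v(A)$ such that: (1) the set of elements of $P_v(A)$ is $R(A)$; (2) $P_v(A)$ is a ranked poset which is rank-symmetric (if its height is $m$, the number of elements of rank $i$ equals the number of elements of rank $m-i$ for every $i$), with exactly one element of top rank and exactly one element of bottom rank; (3) whenever $C$ covers $B$ in $P_v(A)$, the ranking $C$ is obtained from $B$ by a vertex flip (vertex raising or vertex lowering) at a single vertex $w\neq v$.
   Context: A chromotopology of dimension $n$ is a finite connected simple bipartite graph in which every vertex has degree $n$, whose edges are colored by $[n]$ so that each vertex is incident to exactly one edge of each color, and such that for any distinct colors $i,j$ the edges of colors $i,j$ form a disjoint union of $4$-cycles. A ranking of $A$ is a function $h\colon V(A)\to\mathbf{Z}$ with $|h(u)-h(w)|=1$ for every edge $\{u,w\}$, considered up to adding a constant (equivalently, a ranked-poset structure having $A$ as Hasse diagram); $R(A)$ is the set of rankings. A vertex $w$ is a source (resp. sink) if all its neighbors have larger (resp. smaller) $h$-value. Vertex raising at a source $w$ replaces $h$ by $h+2\cdot\mathbf{1}_w$; vertex lowering at a sink $w$ replaces $h$ by $h-2\cdot\mathbf{1}_w$; both are called vertex flips. -}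

module Defs where

open import Level using (0ℓ)
open import Data.Nat using (ℕ; suc; _≤_; _∸_)
open import Data.Fin using (Fin; _≟_)
open import Data.Bool using (Bool)
open import Data.Integer using (ℤ; _+_; _-_; _<_; ∣_∣; 1ℤ)
open import Data.List using (List; []; _∷_; length)
open import Data.List.Relation.Unary.All using (All)
open import Data.List.Relation.Unary.Any using (Any)
open import Data.List.Relation.Unary.AllPairs using (AllPairs)
open import Data.Product using (Σ; ∃; _×_; _,_)
open import Data.Sum using (_⊎_)
open import Relation.Nullary using (¬_; yes; no)
open import Relation.Binary.PropositionalEquality using (_≡_; _≢_)
open import Relation.Binary using (Rel)

-- Since every vertex is incident to exactly one
-- edge of each colour i ∈ Fin n, the coloured edge set is encoded by the
-- function  nbr x i  = the other endpoint of the colour-i edge at x.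
-- The edges are the pairs {x , nbr x i}, of colour i.

walk : ∀ {N n} → (Fin N → Fin n → Fin N) → Fin N → List (Fin n) → Fin N
walk nbr x []       = x
walk nbr x (i ∷ is) = walk nbr (nbr x i) is

record Chromotopology (n : ℕ) : Set where
  field
    N          : ℕ
    nbr        : Fin N → Fin n → Fin N
    -- the colour-i edge at x is also the colour-i edge at its other end
    nbr-invol  : ∀ x i → nbr (nbr x i) i ≡ x
    loopless   : ∀ x i → nbr x i ≢ x
    no-multi   : ∀ x i j → nbr x i ≡ nbr x j → i ≡ j
    bipartite  : Σ (Fin N → Bool) λ side → ∀ x i → side (nbr x i) ≢ side x
    connected  : ∀ x y → ∃ λ (is : List (Fin n)) → walk nbr x is ≡ y
    -- colours i ≠ j span a disjoint union of 4-cycles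
    -- (x , nbr x i , ... , back to x via the colour-j edge)
    squares    : ∀ x i j → i ≢ j → nbr (nbr (nbr (nbr x i) j) i) j ≡ x

module Order {A : Set} (_≈_ : Rel A 0ℓ) (_⊑_ : Rel A 0ℓ) where

  _⋖_ : A → A → Set
  B ⋖ C = (B ⊑ C) × (¬ (B ≈ C)) × (∀ D → B ⊑ D → D ⊑ C → (D ≈ B) ⊎ (D ≈ C))

  Minimal : A → Set
  Minimal x = ∀ y → y ⊑ x → y ≈ x

  Maximal : A → Set
  Maximal x = ∀ y → x ⊑ y → y ≈ x

  HasCard : (A → Set) → ℕ → Set
  HasCard P k = Σ (List A) λ xs →
      (length xs ≡ k) × All P xs × AllPairs (λ a b → ¬ (a ≈ b)) xs
    × (∀ x → P x → Any (x ≈_) xs)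

  RankSymmetricRanked : Set
  RankSymmetricRanked = Σ (A → ℕ) λ ρ → Σ ℕ λ m →
      (∀ x y → x ≈ y → ρ x ≡ ρ y)
    × (∀ x → ρ x ≤ m)
    × (∀ x → Minimal x → ρ x ≡ 0)
    × (∀ x → Maximal x → ρ x ≡ m)
    × (∀ x y → x ⋖ y → ρ y ≡ suc (ρ x))
    × (∀ i → i ≤ m → Σ ℕ λ k → HasCard (λ x → ρ x ≡ i) k
                               × HasCard (λ x → ρ x ≡ m ∸ i) k)
    × HasCard (λ x → ρ x ≡ 0) 1
    × HasCard (λ x → ρ x ≡ m) 1

module _ {n : ℕ} (A : Chromotopology n) where
  open Chromotopology A

  Vertex : Set
  Vertex = Fin N

  record Ranking : Set where
    constructor ranking
    field
      h  : Fin N → ℤ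
      ok : ∀ x i → ∣ h (nbr x i) - h x ∣ ≡ 1

  SameUpToConst : (Fin N → ℤ) → (Fin N → ℤ) → Set
  SameUpToConst f g = ∃ λ (c : ℤ) → ∀ x → g x ≡ f x + c

  -- R(A): rankings modulo additive constants (as a setoid)
  _≈R_ : Rel Ranking 0ℓ
  B ≈R C = SameUpToConst (Ranking.h B) (Ranking.h C)

  IsSource : (Fin N → ℤ) → Fin N → Set
  IsSource f w = ∀ i → f w < f (nbr w i)

  IsSink : (Fin N → ℤ) → Fin N → Set
  IsSink f w = ∀ i → f (nbr w i) < f w

  bump : (Fin N → ℤ) → Fin N → ℤ → Fin N → ℤ
  bump f w c x with x ≟ w
  ... | yes _ = f x + c
  ... | no  _ = f x

  VertexFlip : Ranking → Ranking → Fin N → Set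
  VertexFlip B C w =
      (IsSource (Ranking.h B) w
        × SameUpToConst (bump (Ranking.h B) w (1ℤ + 1ℤ)) (Ranking.h C))
    ⊎ (IsSink (Ranking.h B) w
        × SameUpToConst (bump (Ranking.h B) w (Data.Integer.-_ (1ℤ + 1ℤ))) (Ranking.h C))

-- Normalise rankings to vanish at v and order them pointwise. Along an edge every ranking
-- moves by ±1, so by connectivity the difference of two rankings has constant parity, hence
-- is even: where B < C, C is at least 2 above B. This makes the pointwise minimum of two
-- rankings a ranking; there are finitely many normalised rankings (heights are bounded by
-- walk lengths), so their meet is a least element and its negation a greatest one. If B < C,
-- a vertex minimising B among those where B < C is a source of B other than v, and raising
-- it stays below C; so covers are vertex raisings, and half the distance to the bottom
-- element is a rank function. Negation reverses the order and sends rank r to m − r.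
module Submission where

open import Defs
open import Level using (0ℓ)
open import Data.Nat using (ℕ)
open import Data.Fin using (Fin)
open import Data.Product using (Σ; _×_)
open import Relation.Binary using (Rel; IsPartialOrder)
open import Relation.Binary.PropositionalEquality using (_≢_)

open import Data.Bool using (Bool; true; false)
open import Data.Fin using (zero; suc; _≟_)
open import Data.Fin.Properties using (any?; all?; suc-injective)
open import Data.Integer
  using (ℤ; +_; -[1+_]; +≤+; ∣_∣; 0ℤ; 1ℤ; -1ℤ; _+_; _-_; -_; _≤_; _<_; _⊓_; pred)
  renaming (suc to sucℤ)
import Data.Integer.Properties as ℤ
open import Data.Integer.Tactic.RingSolver using (solve-∀)
open import Data.List using (List; []; _∷_; _++_; length; map; filter; foldr; concatMap; upTo; allFin; deduplicate)
open import Data.List.Membership.Propositional using (_∈_; find; lose)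
open import Data.List.Membership.Propositional.Properties
  using (∈-map⁺; ∈-++⁺ˡ; ∈-++⁺ʳ; ∈-upTo⁺; ∈-allFin; ∈-filter⁺)
open import Data.List.Properties using (length-map)
open import Data.List.Relation.Unary.All as All using (All; []; _∷_)
open import Data.List.Relation.Unary.All.Properties as All using (all-filter)
open import Data.List.Relation.Unary.Any as Any using (Any; here; there)
import Data.List.Relation.Unary.Any.Properties as Any
open import Data.List.Relation.Unary.AllPairs as AllPairs using (AllPairs; []; _∷_)
import Data.List.Relation.Unary.AllPairs.Properties as AllPairs
open import Data.List.Relation.Unary.Unique.DecSetoid.Properties using (deduplicate-!)
import Data.Nat as ℕ
import Data.Nat.Properties as ℕ
open import Data.Product using (∃; _,_; proj₁; proj₂)
open import Data.Sum as Sum using (_⊎_; inj₁; inj₂)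
import Data.Vec.Functional as Vector
open import Function using (_∘_; case_of_)
open import Relation.Binary using (Setoid; DecSetoid; IsEquivalence; _Respects_; tri<; tri≈; tri>)
open import Relation.Binary.PropositionalEquality
  using (_≡_; _≗_; refl; sym; trans; cong; cong₂; subst; subst₂)
open import Relation.Nullary using (¬_; Dec; yes; no; contradiction)
open import Relation.Nullary.Decidable using (map′; decidable-stable)
open import Relation.Unary using (Decidable)

open import Algebra.Properties.CommutativeMonoid.Sum ℕ.+-0-commutativeMonoid
  using (sum; sum-cong-≗; sum-replicate-zero; ∑-distrib-+)

-- Unit steps and parity in ℤ

data UnitStep (i j : ℤ) : Set where
  step-up   : i ≡ sucℤ j → UnitStep i j
  step-down : i ≡ pred j → UnitStep i j

∣i∣≡1⇒i≡1⊎i≡-1 : ∀ i → ∣ i ∣ ≡ 1 → i ≡ 1ℤ ⊎ i ≡ -1ℤ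
∣i∣≡1⇒i≡1⊎i≡-1 (+ 1)                 _  = inj₁ refl
∣i∣≡1⇒i≡1⊎i≡-1 -[1+ 0 ]              _  = inj₂ refl
∣i∣≡1⇒i≡1⊎i≡-1 (+ 0)                 ()
∣i∣≡1⇒i≡1⊎i≡-1 (+ ℕ.suc (ℕ.suc _))   ()
∣i∣≡1⇒i≡1⊎i≡-1 -[1+ ℕ.suc _ ]        ()

∣i-j∣≡1⇒UnitStep : ∀ i j → ∣ i - j ∣ ≡ 1 → UnitStep i j
∣i-j∣≡1⇒UnitStep i j ∣i-j∣≡1 = Sum.[ step-up ∘ shift , step-down ∘ shift ]′ (∣i∣≡1⇒i≡1⊎i≡-1 (i - j) ∣i-j∣≡1)
  where
  i≡[i-j]+j : ∀ a b → a ≡ (a - b) + b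
  i≡[i-j]+j = solve-∀
  shift : ∀ {d} → i - j ≡ d → i ≡ d + j
  shift refl = i≡[i-j]+j i j

pred[i]<suc[i] : ∀ i → pred i < sucℤ i
pred[i]<suc[i] i = ℤ.<-trans (ℤ.i≤pred[j]⇒i<j {pred i} {i} ℤ.≤-refl) (ℤ.suc[i]≤j⇒i<j {i} ℤ.≤-refl)

UnitStep⇒≤suc : ∀ {i j} → UnitStep i j → i ≤ sucℤ j
UnitStep⇒≤suc (step-up refl) = ℤ.≤-refl
UnitStep⇒≤suc {j = j} (step-down refl) = ℤ.<⇒≤ (pred[i]<suc[i] j)

UnitStep⇒pred≤ : ∀ {i j} → UnitStep i j → pred j ≤ i
UnitStep⇒pred≤ {j = j} (step-up refl) = ℤ.<⇒≤ (pred[i]<suc[i] j)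
UnitStep⇒pred≤ (step-down refl) = ℤ.≤-refl

Even : ℤ → Set
Even i = ∃ λ k → i ≡ k + k

¬Even-1 : ¬ Even 1ℤ
¬Even-1 (+ 0 , ())
¬Even-1 (+ ℕ.suc k , 1≡k+k) = ℕ.m+1+n≢0 k (sym (ℕ.suc-injective (ℤ.+-injective 1≡k+k)))
¬Even-1 (-[1+ _ ] , ())

Even-+2 : ∀ {i} → Even i → Even (i + (1ℤ + 1ℤ))
Even-+2 (k , refl) = 1ℤ + k , lemma k
  where
  lemma : ∀ k → (k + k) + (1ℤ + 1ℤ) ≡ (1ℤ + k) + (1ℤ + k)
  lemma = solve-∀

Even--2 : ∀ {i} → Even i → Even (i - (1ℤ + 1ℤ))
Even--2 (k , refl) = -1ℤ + k , lemma k
  where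
  lemma : ∀ k → (k + k) - (1ℤ + 1ℤ) ≡ (-1ℤ + k) + (-1ℤ + k)
  lemma = solve-∀

UnitStep-Even : ∀ {i i′ j j′} → UnitStep i′ i → UnitStep j′ j → Even (i - j) → Even (i′ - j′)
UnitStep-Even {i} {j = j} (step-up refl) (step-up refl) = subst Even (lemma i j)
  where
  lemma : ∀ a b → a - b ≡ (1ℤ + a) - (1ℤ + b)
  lemma = solve-∀
UnitStep-Even {i} {j = j} (step-down refl) (step-down refl) = subst Even (lemma i j)
  where
  lemma : ∀ a b → a - b ≡ (-1ℤ + a) - (-1ℤ + b)
  lemma = solve-∀
UnitStep-Even {i} {j = j} (step-up refl) (step-down refl) = subst Even (lemma i j) ∘ Even-+2
  where
  lemma : ∀ a b → (a - b) + (1ℤ + 1ℤ) ≡ (1ℤ + a) - (-1ℤ + b)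
  lemma = solve-∀
UnitStep-Even {i} {j = j} (step-down refl) (step-up refl) = subst Even (lemma i j) ∘ Even--2
  where
  lemma : ∀ a b → (a - b) - (1ℤ + 1ℤ) ≡ (-1ℤ + a) - (1ℤ + b)
  lemma = solve-∀

i<j∧Even[j-i]⇒suc[i]≤pred[j] : ∀ {i j} → i < j → Even (j - i) → sucℤ i ≤ pred j
i<j∧Even[j-i]⇒suc[i]≤pred[j] {i} {j} i<j even =
  ℤ.i<j⇒i≤pred[j] (ℤ.≤∧≢⇒< (ℤ.i<j⇒suc[i]≤j i<j) suc[i]≢j)
  where
  suc[a]-a≡1 : ∀ a → (1ℤ + a) - a ≡ 1ℤ
  suc[a]-a≡1 = solve-∀
  suc[i]≢j : sucℤ i ≢ j
  suc[i]≢j refl = ¬Even-1 (subst Even (suc[a]-a≡1 i) even)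

suc[i]≤pred[j]⇒i+2≤j : ∀ {i j} → sucℤ i ≤ pred j → i + (1ℤ + 1ℤ) ≤ j
suc[i]≤pred[j]⇒i+2≤j {i} {j} le = subst₂ _≤_ (lhs i) (rhs j) (ℤ.+-monoʳ-≤ 1ℤ le)
  where
  lhs : ∀ a → 1ℤ + (1ℤ + a) ≡ a + (1ℤ + 1ℤ)
  lhs = solve-∀
  rhs : ∀ a → 1ℤ + (-1ℤ + a) ≡ a
  rhs = solve-∀

i+2≢i : ∀ i → i + (1ℤ + 1ℤ) ≢ i
i+2≢i i eq = case trans (sym (lemma i)) (trans (cong (_- i) eq) (ℤ.+-inverseʳ i)) of λ ()
  where
  lemma : ∀ a → (a + (1ℤ + 1ℤ)) - a ≡ 1ℤ + 1ℤ
  lemma = solve-∀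

∣i+2∣≡2+∣i∣ : ∀ {i} → 0ℤ ≤ i → ∣ i + (1ℤ + 1ℤ) ∣ ≡ 2 ℕ.+ ∣ i ∣
∣i+2∣≡2+∣i∣ {+ k} _ = ℕ.+-comm k 2

∣i+j∣≡∣i∣+∣j∣ : ∀ {i j} → 0ℤ ≤ i → 0ℤ ≤ j → ∣ i + j ∣ ≡ ∣ i ∣ ℕ.+ ∣ j ∣
∣i+j∣≡∣i∣+∣j∣ {+ _} {+ _} _ _ = refl

0≤i≤j⇒∣i∣≤∣j∣ : ∀ {i j} → 0ℤ ≤ i → i ≤ j → ∣ i ∣ ℕ.≤ ∣ j ∣
0≤i≤j⇒∣i∣≤∣j∣ (+≤+ _) (+≤+ m≤n) = m≤n

∣i∣-even : ∀ {i} → 0ℤ ≤ i → Even i → ∃ λ j → ∣ i ∣ ≡ j ℕ.+ j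
∣i∣-even _ (+ j , refl) = j , refl

⌊m+n/2⌋≡⌊m/2⌋+⌊n/2⌋ : ∀ {m} n → (∃ λ j → m ≡ j ℕ.+ j) → ℕ.⌊ m ℕ.+ n /2⌋ ≡ ℕ.⌊ m /2⌋ ℕ.+ ℕ.⌊ n /2⌋
⌊m+n/2⌋≡⌊m/2⌋+⌊n/2⌋ n (ℕ.zero  , refl) = refl
⌊m+n/2⌋≡⌊m/2⌋+⌊n/2⌋ n (ℕ.suc j , refl) rewrite ℕ.+-suc j j = cong ℕ.suc (⌊m+n/2⌋≡⌊m/2⌋+⌊n/2⌋ n (j , refl))

f≤sum : ∀ {k} (f : Fin k → ℕ) i → f i ℕ.≤ sum f
f≤sum f zero    = ℕ.m≤m+n _ _
f≤sum f (suc i) = ℕ.≤-trans (f≤sum (f ∘ suc) i) (ℕ.m≤n+m _ _)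

sum-mono-≤ : ∀ {k} {f g : Fin k → ℕ} → (∀ i → f i ℕ.≤ g i) → sum f ℕ.≤ sum g
sum-mono-≤ {ℕ.zero}  f≤g = ℕ.z≤n
sum-mono-≤ {ℕ.suc k} f≤g = ℕ.+-mono-≤ (f≤g zero) (sum-mono-≤ (f≤g ∘ suc))

sum-increment : ∀ {k} {f g : Fin k → ℕ} w → (∀ i → i ≢ w → g i ≡ f i) → g w ≡ ℕ.suc (f w) →
                sum g ≡ ℕ.suc (sum f)
sum-increment zero    g≡f gw≡1+fw =
  cong₂ ℕ._+_ gw≡1+fw (sum-cong-≗ (λ i → g≡f (suc i) λ ()))
sum-increment {f = f} (suc w) g≡f gw≡1+fw = trans
  (cong₂ ℕ._+_ (g≡f zero λ ()) (sum-increment w (λ i i≢w → g≡f (suc i) (i≢w ∘ suc-injective)) gw≡1+fw))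
  (ℕ.+-suc (f zero) _)

integersWithin : ℕ → List ℤ
integersWithin M = map +_ (upTo (ℕ.suc M)) ++ map (-_ ∘ +_) (upTo (ℕ.suc M))

∈-integersWithin : ∀ {M} i → ∣ i ∣ ℕ.≤ M → i ∈ integersWithin M
∈-integersWithin {M} i ∣i∣≤M = Sum.[ nonNegative , negative ]′ (ℤ.+∣i∣≡i⊎+∣i∣≡-i i)
  where
  ∣i∣∈range : ∣ i ∣ ∈ upTo (ℕ.suc M)
  ∣i∣∈range = ∈-upTo⁺ (ℕ.s≤s ∣i∣≤M)
  nonNegative : + ∣ i ∣ ≡ i → i ∈ integersWithin M
  nonNegative +∣i∣≡i = ∈-++⁺ˡ (subst (_∈ map +_ (upTo (ℕ.suc M))) +∣i∣≡i (∈-map⁺ +_ ∣i∣∈range))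
  negative : + ∣ i ∣ ≡ - i → i ∈ integersWithin M
  negative +∣i∣≡-i = ∈-++⁺ʳ (map +_ (upTo (ℕ.suc M)))
    (subst (_∈ map (-_ ∘ +_) (upTo (ℕ.suc M))) (trans (cong -_ +∣i∣≡-i) (ℤ.neg-involutive i))
      (∈-map⁺ (-_ ∘ +_) ∣i∣∈range))

functionsInto : ∀ {X : Set} → List X → (k : ℕ) → List (Fin k → X)
functionsInto xs ℕ.zero    = (λ ()) ∷ []
functionsInto xs (ℕ.suc k) = concatMap (λ x → map (Vector._∷_ x) (functionsInto xs k)) xs

functionsInto-complete : ∀ {X : Set} (xs : List X) k (g : Fin k → X) → (∀ i → g i ∈ xs) →
                         Any (_≗ g) (functionsInto xs k)
functionsInto-complete xs ℕ.zero    g _   = here λ ()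
functionsInto-complete xs (ℕ.suc k) g g∈xs = Any.concatMap⁺ _ (Any.map extendTail (g∈xs zero))
  where
  extend : ∀ {x f} → g zero ≡ x → f ≗ g ∘ suc → Vector._∷_ x f ≗ g
  extend g0≡x f≗ zero    = sym g0≡x
  extend g0≡x f≗ (suc i) = f≗ i
  extendTail : ∀ {x} → g zero ≡ x → Any (_≗ g) (map (Vector._∷_ x) (functionsInto xs k))
  extendTail g0≡x = Any.map⁺ (Any.map (extend g0≡x) (functionsInto-complete xs k (g ∘ suc) (g∈xs ∘ suc)))

module _ {k} {P : Fin k → Set} (P? : Decidable P) (f : Fin k → ℤ) where
  open import Data.List.Extrema ℤ.≤-totalOrder using (argmin; argmin-all; f[argmin]≤f[xs])

  minimiser : ∃ P → ∃ λ w → P w × (∀ y → P y → f w ≤ f y)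
  minimiser (w₀ , Pw₀) = argmin f w₀ candidates , argmin-all f {P = P} Pw₀ (all-filter P? (allFin k)) , least
    where
    candidates : List (Fin k)
    candidates = filter P? (allFin k)
    least : ∀ y → P y → f (argmin f w₀ candidates) ≤ f y
    least y Py = All.lookup (f[argmin]≤f[xs] {f = f} w₀ candidates) (∈-filter⁺ P? (∈-allFin y) Py)

module Counting (S : Setoid 0ℓ 0ℓ) (_⊑_ : Rel (Setoid.Carrier S) 0ℓ) where
  open Setoid S using (Carrier; _≈_) renaming (sym to ≈-sym; trans to ≈-trans)
  open Order _≈_ _⊑_ using (HasCard)

  hasCard-filter : ∀ {P} (P? : Decidable P) → P Respects _≈_ → ∀ {xs} → (∀ x → Any (x ≈_) xs) →
                   AllPairs (λ a b → ¬ a ≈ b) xs → HasCard P (length (filter P? xs))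
  hasCard-filter {P} P? resp {xs} exhaustive unique =
    filter P? xs , refl , all-filter P? xs , AllPairs.filter⁺ P? unique , complete
    where
    complete : ∀ x → P x → Any (x ≈_) (filter P? xs)
    complete x Px with find (exhaustive x)
    ... | y , y∈xs , x≈y = lose (∈-filter⁺ P? y∈xs (resp x≈y Px)) x≈y

  hasCard-singleton : ∀ {P} a → P a → (∀ x → P x → x ≈ a) → HasCard P 1
  hasCard-singleton a Pa unique = a ∷ [] , refl , Pa ∷ [] , [] ∷ [] , λ x Px → here (unique x Px)

  hasCard-image : ∀ {P Q k} (f : Carrier → Carrier) →
                  (∀ {x y} → x ≈ y → f x ≈ f y) → (∀ {x y} → f x ≈ f y → x ≈ y) →
                  (∀ {x} → P x → Q (f x)) → (∀ {y} → Q y → ∃ λ x → P x × y ≈ f x) →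
                  HasCard P k → HasCard Q k
  hasCard-image {Q = Q} f f-cong f-injective P⇒Q Q⇒P (xs , ∣xs∣≡k , allP , unique , complete) =
      map f xs , trans (length-map f xs) ∣xs∣≡k , All.map⁺ (All.map P⇒Q allP)
    , AllPairs.map⁺ (AllPairs.map (λ x≉y → x≉y ∘ f-injective) unique) , complete′
    where
    complete′ : ∀ y → Q y → Any (y ≈_) (map f xs)
    complete′ y Qy with Q⇒P Qy
    ... | x , Px , y≈fx = Any.map⁺ (Any.map (λ x≈z → ≈-trans y≈fx (f-cong x≈z)) (complete x Px))

-- Rankings of a chromotopology

module RankingsOf {n} (A : Chromotopology n) where
  open Chromotopology A
  open Ranking

  ranking-step : ∀ (B : Ranking A) x i → UnitStep (h B (nbr x i)) (h B x)
  ranking-step B x i = ∣i-j∣≡1⇒UnitStep _ _ (ok B x i)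

  walk-bound : ∀ (B : Ranking A) x is → ∣ h B (walk nbr x is) - h B x ∣ ℕ.≤ length is
  walk-bound B x []       = ℕ.≤-reflexive (cong ∣_∣ (ℤ.+-inverseʳ (h B x)))
  walk-bound B x (i ∷ is) = begin
    ∣ h B z - h B x ∣                              ≡⟨ cong ∣_∣ (split (h B z) (h B y) (h B x)) ⟩
    ∣ (h B z - h B y) + (h B y - h B x) ∣          ≤⟨ ℤ.∣i+j∣≤∣i∣+∣j∣ (h B z - h B y) (h B y - h B x) ⟩
    ∣ h B z - h B y ∣ ℕ.+ ∣ h B y - h B x ∣        ≤⟨ ℕ.+-mono-≤ (walk-bound B y is) (ℕ.≤-reflexive (ok B x i)) ⟩
    length is ℕ.+ 1                                ≡⟨ ℕ.+-comm (length is) 1 ⟩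
    ℕ.suc (length is)                              ∎
    where
    open ℕ.≤-Reasoning
    y z : Vertex A
    y = nbr x i
    z = walk nbr y is
    split : ∀ a b c → a - c ≡ (a - b) + (b - c)
    split = solve-∀

  IsRanking : (Vertex A → ℤ) → Set
  IsRanking f = ∀ x i → ∣ f (nbr x i) - f x ∣ ≡ 1

  isRanking? : ∀ f → Dec (IsRanking f)
  isRanking? f = all? λ x → all? λ i → ∣ f (nbr x i) - f x ∣ ℕ.≟ 1

  negate : Ranking A → Ranking A
  negate B = ranking (-_ ∘ h B) λ x i → begin
    ∣ - h B (nbr x i) - - h B x ∣   ≡⟨ cong ∣_∣ (-a--b≡-[a-b] (h B (nbr x i)) (h B x)) ⟩
    ∣ - (h B (nbr x i) - h B x) ∣   ≡⟨ ℤ.∣-i∣≡∣i∣ (h B (nbr x i) - h B x) ⟩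
    ∣ h B (nbr x i) - h B x ∣       ≡⟨ ok B x i ⟩
    1                               ∎
    where
    open Relation.Binary.PropositionalEquality.≡-Reasoning
    -a--b≡-[a-b] : ∀ a b → - a - - b ≡ - (a - b)
    -a--b≡-[a-b] = solve-∀

  sideRanking : Ranking A
  sideRanking = ranking (bit ∘ proj₁ bipartite) λ x i → ∣bit-bit∣ (proj₂ bipartite x i)
    where
    bit : Bool → ℤ
    bit true  = 1ℤ
    bit false = 0ℤ
    ∣bit-bit∣ : ∀ {a b} → a ≢ b → ∣ bit a - bit b ∣ ≡ 1
    ∣bit-bit∣ {true}  {true}  a≢b = contradiction refl a≢b
    ∣bit-bit∣ {true}  {false} _   = refl
    ∣bit-bit∣ {false} {true}  _   = refl
    ∣bit-bit∣ {false} {false} a≢b = contradiction refl a≢b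

  bump-at : ∀ f w c → bump A f w c w ≡ f w + c
  bump-at f w c with w ≟ w
  ... | yes _   = refl
  ... | no  w≢w = contradiction refl w≢w

  bump-off : ∀ f w c x → x ≢ w → bump A f w c x ≡ f x
  bump-off f w c x x≢w with x ≟ w
  ... | yes x≡w = contradiction x≡w x≢w
  ... | no  _   = refl

  source-step : ∀ (B : Ranking A) w → IsSource A (h B) w → ∀ i → h B (nbr w i) ≡ sucℤ (h B w)
  source-step B w src i with ranking-step B w i
  ... | step-up   up   = up
  ... | step-down down = contradiction (subst (h B w <_) down (src i)) (ℤ.<-asym (ℤ.i≤pred[j]⇒i<j {pred (h B w)} ℤ.≤-refl))

  raise-isRanking : ∀ (B : Ranking A) w → IsSource A (h B) w → IsRanking (bump A (h B) w (1ℤ + 1ℤ))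
  raise-isRanking B w src x i = onEdge (x ≟ w) (nbr x i ≟ w)
    where
    f : Vertex A → ℤ
    f = bump A (h B) w (1ℤ + 1ℤ)
    ∣suc[a]-[a+2]∣≡1 : ∀ a → ∣ (1ℤ + a) - (a + (1ℤ + 1ℤ)) ∣ ≡ 1
    ∣suc[a]-[a+2]∣≡1 a = cong ∣_∣ (lemma a)
      where
      lemma : ∀ a → (1ℤ + a) - (a + (1ℤ + 1ℤ)) ≡ -1ℤ
      lemma = solve-∀
    ∣[a+2]-suc[a]∣≡1 : ∀ a → ∣ (a + (1ℤ + 1ℤ)) - (1ℤ + a) ∣ ≡ 1
    ∣[a+2]-suc[a]∣≡1 a = cong ∣_∣ (lemma a)
      where
      lemma : ∀ a → (a + (1ℤ + 1ℤ)) - (1ℤ + a) ≡ 1ℤ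
      lemma = solve-∀
    onEdge : Dec (x ≡ w) → Dec (nbr x i ≡ w) → ∣ f (nbr x i) - f x ∣ ≡ 1
    onEdge (yes refl) (yes y≡x) = contradiction y≡x (loopless x i)
    onEdge (yes refl) (no  y≢x) = subst₂ (λ a b → ∣ a - b ∣ ≡ 1)
      (sym (trans (bump-off (h B) x _ _ y≢x) (source-step B x src i))) (sym (bump-at (h B) x _))
      (∣suc[a]-[a+2]∣≡1 (h B x))
    onEdge (no  x≢y) (yes refl) = subst₂ (λ a b → ∣ a - b ∣ ≡ 1)
      (sym (bump-at (h B) (nbr x i) _))
      (sym (trans (bump-off (h B) _ _ x x≢y) (trans (cong (h B) (sym (nbr-invol x i))) (source-step B (nbr x i) src i))))
      (∣[a+2]-suc[a]∣≡1 (h B (nbr x i)))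
    onEdge (no  x≢w) (no  y≢w) = subst₂ (λ a b → ∣ a - b ∣ ≡ 1)
      (sym (bump-off (h B) w _ _ y≢w)) (sym (bump-off (h B) w _ x x≢w)) (ok B x i)

  raise : (B : Ranking A) (w : Vertex A) → IsSource A (h B) w → Ranking A
  raise B w src = ranking (bump A (h B) w (1ℤ + 1ℤ)) (raise-isRanking B w src)

-- Rankings normalised at a base vertex, ordered pointwise

module Normalised {n} (A : Chromotopology n) (v : Vertex A) where
  open Chromotopology A
  open Ranking
  open RankingsOf A

  hᵥ : Ranking A → Vertex A → ℤ
  hᵥ B x = h B x - h B v

  hᵥ-base : ∀ B → hᵥ B v ≡ 0ℤ
  hᵥ-base B = ℤ.+-inverseʳ (h B v)

  h[v]≡0⇒hᵥ≗h : ∀ B → h B v ≡ 0ℤ → hᵥ B ≗ h B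
  h[v]≡0⇒hᵥ≗h B hv≡0 x = trans (cong (λ c → h B x - c) hv≡0) (ℤ.+-identityʳ (h B x))

  hᵥ-isRanking : ∀ B → IsRanking (hᵥ B)
  hᵥ-isRanking B x i = trans (cong ∣_∣ (lemma (h B (nbr x i)) (h B x) (h B v))) (ok B x i)
    where
    lemma : ∀ a b c → (a - c) - (b - c) ≡ a - b
    lemma = solve-∀

  hᵥ-step : ∀ B x i → UnitStep (hᵥ B (nbr x i)) (hᵥ B x)
  hᵥ-step B x i = ∣i-j∣≡1⇒UnitStep _ _ (hᵥ-isRanking B x i)

  hᵥ-<⇒h-< : ∀ B {x y} → hᵥ B x < hᵥ B y → h B x < h B y
  hᵥ-<⇒h-< B {x} {y} lt =
    subst₂ _<_ (lemma (h B x) (h B v)) (lemma (h B y) (h B v)) (ℤ.+-monoˡ-< (h B v) lt)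
    where
    lemma : ∀ a c → (a - c) + c ≡ a
    lemma = solve-∀

  -- _≈_ and _⊑_ unfold to statements about h, so Agda cannot infer the rankings they relate;
  -- hence the explicitly supplied implicit arguments throughout.
  _≈_ : Rel (Ranking A) 0ℓ
  _≈_ = _≈R_ A

  ≈⇒hᵥ≗ : ∀ {B C} → B ≈ C → hᵥ B ≗ hᵥ C
  ≈⇒hᵥ≗ {B} {C} (c , C≡B+c) x =
    trans (sym (lemma (h B x) (h B v) c)) (sym (cong₂ _-_ (C≡B+c x) (C≡B+c v)))
    where
    lemma : ∀ a b c → (a + c) - (b + c) ≡ a - b
    lemma = solve-∀

  hᵥ≗⇒≈ : ∀ {B C} → hᵥ B ≗ hᵥ C → B ≈ C
  hᵥ≗⇒≈ {B} {C} B≗C = h C v - h B v , λ x → begin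
    h C x                          ≡⟨ lemma₁ (h C x) (h C v) ⟩
    (h C x - h C v) + h C v        ≡⟨ cong (_+ h C v) (B≗C x) ⟨
    (h B x - h B v) + h C v        ≡⟨ lemma₂ (h B x) (h B v) (h C v) ⟩
    h B x + (h C v - h B v)        ∎
    where
    open Relation.Binary.PropositionalEquality.≡-Reasoning
    lemma₁ : ∀ a c → a ≡ (a - c) + c
    lemma₁ = solve-∀
    lemma₂ : ∀ a b c → (a - b) + c ≡ a + (c - b)
    lemma₂ = solve-∀

  ≈-isEquivalence : IsEquivalence _≈_
  ≈-isEquivalence = record
    { refl  = λ {B} → hᵥ≗⇒≈ {B} {B} λ _ → refl
    ; sym   = λ {B} {C} B≈C → hᵥ≗⇒≈ {C} {B} (sym ∘ ≈⇒hᵥ≗ {B} {C} B≈C)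
    ; trans = λ {B} {C} {D} B≈C C≈D → hᵥ≗⇒≈ {B} {D} λ x → trans (≈⇒hᵥ≗ {B} {C} B≈C x) (≈⇒hᵥ≗ {C} {D} C≈D x)
    }

  open IsEquivalence ≈-isEquivalence using () renaming (sym to ≈-sym; trans to ≈-trans)

  _≈?_ : ∀ B C → Dec (B ≈ C)
  B ≈? C = map′ (hᵥ≗⇒≈ {B} {C}) (≈⇒hᵥ≗ {B} {C}) (all? λ x → hᵥ B x ℤ.≟ hᵥ C x)

  rankingDecSetoid : DecSetoid 0ℓ 0ℓ
  rankingDecSetoid = record
    { Carrier          = Ranking A
    ; _≈_              = _≈_
    ; isDecEquivalence = record { isEquivalence = ≈-isEquivalence ; _≟_ = _≈?_ }
    }

  _⊑_ : Rel (Ranking A) 0ℓ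
  B ⊑ C = ∀ x → hᵥ B x ≤ hᵥ C x

  ⊑-trans : ∀ {B C D} → B ⊑ C → C ⊑ D → B ⊑ D
  ⊑-trans B⊑C C⊑D x = ℤ.≤-trans (B⊑C x) (C⊑D x)

  ⊑-isPartialOrder : IsPartialOrder _≈_ _⊑_
  ⊑-isPartialOrder = record
    { isPreorder = record
      { isEquivalence = ≈-isEquivalence
      ; reflexive     = λ {B} {C} B≈C x → ℤ.≤-reflexive (≈⇒hᵥ≗ {B} {C} B≈C x)
      ; trans         = λ {B} {C} {D} → ⊑-trans {B} {C} {D}
      }
    ; antisym = λ {B} {C} B⊑C C⊑B → hᵥ≗⇒≈ {B} {C} λ x → ℤ.≤-antisym (B⊑C x) (C⊑B x)
    }

  walk-parity : ∀ B C y is → Even (hᵥ C y - hᵥ B y) →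
                Even (hᵥ C (walk nbr y is) - hᵥ B (walk nbr y is))
  walk-parity B C y []       even = even
  walk-parity B C y (i ∷ is) even =
    walk-parity B C (nbr y i) is (UnitStep-Even (hᵥ-step C y i) (hᵥ-step B y i) even)

  hᵥ-parity : ∀ B C x → Even (hᵥ C x - hᵥ B x)
  hᵥ-parity B C x with connected v x
  ... | is , refl = walk-parity B C v is (0ℤ , cong₂ _-_ (hᵥ-base C) (hᵥ-base B))

  strictly-below⇒gap : ∀ B C x → hᵥ B x < hᵥ C x → sucℤ (hᵥ B x) ≤ pred (hᵥ C x)
  strictly-below⇒gap B C x B<C = i<j∧Even[j-i]⇒suc[i]≤pred[j] B<C (hᵥ-parity B C x)

  strictly-below-propagates : ∀ B C x i → hᵥ B x < hᵥ C x → hᵥ B (nbr x i) ≤ hᵥ C (nbr x i)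
  strictly-below-propagates B C x i B<C =
    ℤ.≤-trans (UnitStep⇒≤suc (hᵥ-step B x i))
      (ℤ.≤-trans (strictly-below⇒gap B C x B<C) (UnitStep⇒pred≤ (hᵥ-step C x i)))

  meet-isRanking : ∀ B C → IsRanking (λ x → hᵥ B x ⊓ hᵥ C x)
  meet-isRanking B C x i with ℤ.<-cmp (hᵥ B x) (hᵥ C x)
  ... | tri< B<C _ _
    rewrite ℤ.i≤j⇒i⊓j≡i (ℤ.<⇒≤ B<C) | ℤ.i≤j⇒i⊓j≡i (strictly-below-propagates B C x i B<C) = hᵥ-isRanking B x i
  ... | tri> _ _ C<B
    rewrite ℤ.i≥j⇒i⊓j≡j (ℤ.<⇒≤ C<B) | ℤ.i≥j⇒i⊓j≡j (strictly-below-propagates C B x i C<B) = hᵥ-isRanking C x i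
  ... | tri≈ _ B≡C _ with ℤ.≤-total (hᵥ B (nbr x i)) (hᵥ C (nbr x i))
  ...   | inj₁ B≤C rewrite ℤ.i≤j⇒i⊓j≡i B≤C | ℤ.i≤j⇒i⊓j≡i (ℤ.≤-reflexive B≡C) = hᵥ-isRanking B x i
  ...   | inj₂ C≤B rewrite ℤ.i≥j⇒i⊓j≡j C≤B | ℤ.i≥j⇒i⊓j≡j (ℤ.≤-reflexive (sym B≡C)) = hᵥ-isRanking C x i

  meet : Ranking A → Ranking A → Ranking A
  meet B C = ranking (λ x → hᵥ B x ⊓ hᵥ C x) (meet-isRanking B C)

  hᵥ-meet : ∀ B C → hᵥ (meet B C) ≗ λ x → hᵥ B x ⊓ hᵥ C x
  hᵥ-meet B C = h[v]≡0⇒hᵥ≗h (meet B C) (cong₂ _⊓_ (hᵥ-base B) (hᵥ-base C))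

  meet-⊑ˡ : ∀ B C → meet B C ⊑ B
  meet-⊑ˡ B C x = subst (_≤ hᵥ B x) (sym (hᵥ-meet B C x)) (ℤ.i⊓j≤i (hᵥ B x) (hᵥ C x))

  meet-⊑ʳ : ∀ B C → meet B C ⊑ C
  meet-⊑ʳ B C x = subst (_≤ hᵥ C x) (sym (hᵥ-meet B C x)) (ℤ.i⊓j≤j (hᵥ B x) (hᵥ C x))

  foldr-meet-⊑ : ∀ B₀ Cs → All (foldr meet B₀ Cs ⊑_) Cs
  foldr-meet-⊑ B₀ []       = []
  foldr-meet-⊑ B₀ (C ∷ Cs) =
    meet-⊑ˡ C below ∷ All.map (λ {D} → ⊑-trans {meet C below} {below} {D} (meet-⊑ʳ C below)) (foldr-meet-⊑ B₀ Cs)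
    where
    below : Ranking A
    below = foldr meet B₀ Cs

  hᵥ-raise-at : ∀ B w src → w ≢ v → hᵥ (raise B w src) w ≡ hᵥ B w + (1ℤ + 1ℤ)
  hᵥ-raise-at B w src w≢v =
    trans (cong₂ _-_ (bump-at (h B) w _) (bump-off (h B) w _ v (w≢v ∘ sym))) (lemma (h B w) (h B v))
    where
    lemma : ∀ a b → (a + (1ℤ + 1ℤ)) - b ≡ (a - b) + (1ℤ + 1ℤ)
    lemma = solve-∀

  hᵥ-raise-off : ∀ B w src → w ≢ v → ∀ x → x ≢ w → hᵥ (raise B w src) x ≡ hᵥ B x
  hᵥ-raise-off B w src w≢v x x≢w = cong₂ _-_ (bump-off (h B) w _ x x≢w) (bump-off (h B) w _ v (w≢v ∘ sym))

  raise-⊒ : ∀ B w src → w ≢ v → B ⊑ raise B w src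
  raise-⊒ B w src w≢v x = compare (x ≟ w)
    where
    compare : Dec (x ≡ w) → hᵥ B x ≤ hᵥ (raise B w src) x
    compare (yes refl) = subst (hᵥ B x ≤_) (sym (hᵥ-raise-at B x src w≢v)) (ℤ.i≤i+j (hᵥ B x) (1ℤ + 1ℤ))
    compare (no  x≢w)  = ℤ.≤-reflexive (sym (hᵥ-raise-off B w src w≢v x x≢w))

  raise-≉ : ∀ B w src → w ≢ v → ¬ raise B w src ≈ B
  raise-≉ B w src w≢v raised≈B =
    i+2≢i (hᵥ B w) (trans (sym (hᵥ-raise-at B w src w≢v)) (≈⇒hᵥ≗ {raise B w src} {B} raised≈B w))

  ¬≈⇒strictly-below-somewhere : ∀ {B C} → B ⊑ C → ¬ B ≈ C → ∃ λ x → hᵥ B x < hᵥ C x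
  ¬≈⇒strictly-below-somewhere {B} {C} B⊑C B≉C with any? (λ x → hᵥ B x ℤ.<? hᵥ C x)
  ... | yes B<C = B<C
  ... | no  B≮C = contradiction (hᵥ≗⇒≈ {B} {C} λ x → ℤ.≤-antisym (B⊑C x) (ℤ.≮⇒≥ (B≮C ∘ (x ,_)))) B≉C

  RaisableBelow : Ranking A → Ranking A → Set
  RaisableBelow B C = Σ (Vertex A) λ w → w ≢ v × Σ (IsSource A (h B) w) λ src → raise B w src ⊑ C

  -- Raise B at a lowest vertex w where B < C. By parity C ≥ B + 2 at w, so the raise stays below C,
  -- and a neighbour where B is lower than at w would also have B < C, contradicting minimality.
  raisableBelow : ∀ {B C} → B ⊑ C → ¬ B ≈ C → RaisableBelow B C
  raisableBelow {B} {C} B⊑C B≉C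
    with minimiser (λ x → hᵥ B x ℤ.<? hᵥ C x) (hᵥ B) (¬≈⇒strictly-below-somewhere {B} {C} B⊑C B≉C)
  ... | w , Bw<Cw , lowest = w , w≢v , source , raised⊑C
    where
    gap : sucℤ (hᵥ B w) ≤ pred (hᵥ C w)
    gap = strictly-below⇒gap B C w Bw<Cw
    w≢v : w ≢ v
    w≢v refl = ℤ.<-irrefl (trans (hᵥ-base B) (sym (hᵥ-base C))) Bw<Cw
    ascends : ∀ i → hᵥ B w < hᵥ B (nbr w i)
    ascends i with hᵥ-step B w i
    ... | step-up   up   = subst (hᵥ B w <_) (sym up) (ℤ.suc[i]≤j⇒i<j {hᵥ B w} ℤ.≤-refl)
    ... | step-down down = contradiction (lowest (nbr w i) strictly-below) (ℤ.<⇒≱ down-below)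
      where
      down-below : hᵥ B (nbr w i) < hᵥ B w
      down-below = subst (_< hᵥ B w) (sym down) (ℤ.i≤pred[j]⇒i<j {pred (hᵥ B w)} ℤ.≤-refl)
      strictly-below : hᵥ B (nbr w i) < hᵥ C (nbr w i)
      strictly-below = subst (_< hᵥ C (nbr w i)) (sym down)
        (ℤ.<-≤-trans (pred[i]<suc[i] (hᵥ B w)) (ℤ.≤-trans gap (UnitStep⇒pred≤ (hᵥ-step C w i))))
    source : IsSource A (h B) w
    source i = hᵥ-<⇒h-< B (ascends i)
    raised⊑C : raise B w source ⊑ C
    raised⊑C x = compare (x ≟ w)
      where
      compare : Dec (x ≡ w) → hᵥ (raise B w source) x ≤ hᵥ C x
      compare (yes refl) = subst (_≤ hᵥ C x) (sym (hᵥ-raise-at B x source w≢v)) (suc[i]≤pred[j]⇒i+2≤j {hᵥ B x} gap)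
      compare (no  x≢w)  = subst (_≤ hᵥ C x) (sym (hᵥ-raise-off B w source w≢v x x≢w)) (B⊑C x)

  heightBound : ℕ
  heightBound = sum λ x → length (proj₁ (connected v x))

  ∣hᵥ∣≤heightBound : ∀ B x → ∣ hᵥ B x ∣ ℕ.≤ heightBound
  ∣hᵥ∣≤heightBound B x with connected v x | f≤sum (λ y → length (proj₁ (connected v y))) x
  ... | is , refl | ∣is∣≤bound = ℕ.≤-trans (walk-bound B v is) ∣is∣≤bound

  rankingsAmong : List (Vertex A → ℤ) → List (Ranking A)
  rankingsAmong []       = []
  rankingsAmong (f ∷ fs) with isRanking? f
  ... | yes f-ok = ranking f f-ok ∷ rankingsAmong fs
  ... | no  _    = rankingsAmong fs

  rankingsAmong-complete : ∀ B fs → Any (_≗ hᵥ B) fs → Any (B ≈_) (rankingsAmong fs)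
  rankingsAmong-complete B (f ∷ fs) (here f≗hᵥB) with isRanking? f
  ... | yes f-ok = here (hᵥ≗⇒≈ {B} {ranking f f-ok} λ x →
                     sym (trans (h[v]≡0⇒hᵥ≗h (ranking f f-ok) (trans (f≗hᵥB v) (hᵥ-base B)) x) (f≗hᵥB x)))
  ... | no  ¬ok  = contradiction (λ x i → subst₂ (λ a b → ∣ a - b ∣ ≡ 1)
                     (sym (f≗hᵥB (nbr x i))) (sym (f≗hᵥB x)) (hᵥ-isRanking B x i)) ¬ok
  rankingsAmong-complete B (f ∷ fs) (there f∈fs) with isRanking? f
  ... | yes _ = there (rankingsAmong-complete B fs f∈fs)
  ... | no  _ = rankingsAmong-complete B fs f∈fs

  allRankings : List (Ranking A)
  allRankings = deduplicate _≈?_ (rankingsAmong (functionsInto (integersWithin heightBound) N))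

  allRankings-complete : ∀ B → Any (B ≈_) allRankings
  allRankings-complete B =
    Any.deduplicate⁺ _≈?_ (λ {C} {D} D≈C B≈C → ≈-trans {B} {C} {D} B≈C (≈-sym {D} {C} D≈C))
      (rankingsAmong-complete B _ (functionsInto-complete _ N (hᵥ B) λ x →
        ∈-integersWithin (hᵥ B x) (∣hᵥ∣≤heightBound B x)))

  allRankings-unique : AllPairs (λ B C → ¬ B ≈ C) allRankings
  allRankings-unique = deduplicate-! rankingDecSetoid _

  bottom : Ranking A
  bottom = foldr meet sideRanking allRankings

  bottom-least : ∀ B → bottom ⊑ B
  bottom-least B = viaRepresentative {Any.lookup B∈all}
    (All.lookupAny (foldr-meet-⊑ sideRanking allRankings) B∈all)
    where
    B∈all : Any (B ≈_) allRankings
    B∈all = allRankings-complete B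
    viaRepresentative : ∀ {C} → bottom ⊑ C × B ≈ C → bottom ⊑ B
    viaRepresentative {C} (bottom⊑C , B≈C) x = subst (hᵥ bottom x ≤_) (sym (≈⇒hᵥ≗ {B} {C} B≈C x)) (bottom⊑C x)

  hᵥ-negate : ∀ B x → hᵥ (negate B) x ≡ - hᵥ B x
  hᵥ-negate B x = lemma (h B x) (h B v)
    where
    lemma : ∀ a b → - a - - b ≡ - (a - b)
    lemma = solve-∀

  negate-antitone : ∀ {B C} → B ⊑ C → negate C ⊑ negate B
  negate-antitone {B} {C} B⊑C x =
    subst₂ _≤_ (sym (hᵥ-negate C x)) (sym (hᵥ-negate B x)) (ℤ.neg-mono-≤ (B⊑C x))

  negate-involutive : ∀ B → negate (negate B) ≈ B
  negate-involutive B = hᵥ≗⇒≈ {negate (negate B)} {B} λ x →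
    trans (hᵥ-negate (negate B) x) (trans (cong -_ (hᵥ-negate B x)) (ℤ.neg-involutive (hᵥ B x)))

  negate-cong : ∀ {B C} → B ≈ C → negate B ≈ negate C
  negate-cong {B} {C} B≈C = hᵥ≗⇒≈ {negate B} {negate C} λ x →
    trans (hᵥ-negate B x) (trans (cong -_ (≈⇒hᵥ≗ {B} {C} B≈C x)) (sym (hᵥ-negate C x)))

  negate-injective : ∀ {B C} → negate B ≈ negate C → B ≈ C
  negate-injective {B} {C} -B≈-C = hᵥ≗⇒≈ {B} {C} λ x → ℤ.neg-injective
    (trans (sym (hᵥ-negate B x)) (trans (≈⇒hᵥ≗ {negate B} {negate C} -B≈-C x) (hᵥ-negate C x)))

  top : Ranking A
  top = negate bottom

  top-greatest : ∀ B → B ⊑ top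
  top-greatest B x = subst (_≤ hᵥ top x) (≈⇒hᵥ≗ {negate (negate B)} {B} (negate-involutive B) x)
    (negate-antitone {bottom} {negate B} (bottom-least (negate B)) x)

  excess : Ranking A → Vertex A → ℕ
  excess B x = ∣ hᵥ B x - hᵥ bottom x ∣

  rank : Ranking A → ℕ
  rank B = sum λ x → ℕ.⌊ excess B x /2⌋

  bottom≤hᵥ : ∀ B x → 0ℤ ≤ hᵥ B x - hᵥ bottom x
  bottom≤hᵥ B x = ℤ.i≤j⇒0≤j-i (bottom-least B x)

  rank-cong : ∀ {B C} → B ≈ C → rank B ≡ rank C
  rank-cong {B} {C} B≈C = sum-cong-≗ λ x →
    cong (λ a → ℕ.⌊ ∣ a - hᵥ bottom x ∣ /2⌋) (≈⇒hᵥ≗ {B} {C} B≈C x)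

  rank-mono : ∀ {B C} → B ⊑ C → rank B ℕ.≤ rank C
  rank-mono {B} {C} B⊑C = sum-mono-≤ λ x →
    ℕ.⌊n/2⌋-mono (0≤i≤j⇒∣i∣≤∣j∣ (bottom≤hᵥ B x) (ℤ.+-monoˡ-≤ (- hᵥ bottom x) (B⊑C x)))

  rank-bottom : rank bottom ≡ 0
  rank-bottom = trans (sum-cong-≗ λ x → cong (λ a → ℕ.⌊ ∣ a ∣ /2⌋) (ℤ.+-inverseʳ (hᵥ bottom x)))
                      (sum-replicate-zero N)

  rank-raise : ∀ B w src → w ≢ v → rank (raise B w src) ≡ ℕ.suc (rank B)
  rank-raise B w src w≢v = sum-increment w off at
    where
    off : ∀ x → x ≢ w → ℕ.⌊ excess (raise B w src) x /2⌋ ≡ ℕ.⌊ excess B x /2⌋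
    off x x≢w = cong (λ a → ℕ.⌊ ∣ a - hᵥ bottom x ∣ /2⌋) (hᵥ-raise-off B w src w≢v x x≢w)
    lemma : ∀ a b → (a + (1ℤ + 1ℤ)) - b ≡ (a - b) + (1ℤ + 1ℤ)
    lemma = solve-∀
    at : ℕ.⌊ excess (raise B w src) w /2⌋ ≡ ℕ.suc ℕ.⌊ excess B w /2⌋
    at = cong ℕ.⌊_/2⌋ (begin
      ∣ hᵥ (raise B w src) w - hᵥ bottom w ∣        ≡⟨ cong (λ a → ∣ a - hᵥ bottom w ∣) (hᵥ-raise-at B w src w≢v) ⟩
      ∣ (hᵥ B w + (1ℤ + 1ℤ)) - hᵥ bottom w ∣       ≡⟨ cong ∣_∣ (lemma (hᵥ B w) (hᵥ bottom w)) ⟩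
      ∣ (hᵥ B w - hᵥ bottom w) + (1ℤ + 1ℤ) ∣       ≡⟨ ∣i+2∣≡2+∣i∣ (bottom≤hᵥ B w) ⟩
      2 ℕ.+ excess B w                              ∎)
      where open Relation.Binary.PropositionalEquality.≡-Reasoning

  excess-negate : ∀ B x → excess B x ℕ.+ excess (negate B) x ≡ excess top x
  excess-negate B x = begin
    ∣ hᵥ B x - b ∣ ℕ.+ ∣ hᵥ (negate B) x - b ∣   ≡⟨ ∣i+j∣≡∣i∣+∣j∣ (bottom≤hᵥ B x) (bottom≤hᵥ (negate B) x) ⟨
    ∣ (hᵥ B x - b) + (hᵥ (negate B) x - b) ∣     ≡⟨ cong (λ a → ∣ (hᵥ B x - b) + (a - b) ∣) (hᵥ-negate B x) ⟩
    ∣ (hᵥ B x - b) + (- hᵥ B x - b) ∣            ≡⟨ cong ∣_∣ (lemma (hᵥ B x) b) ⟩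
    ∣ - b - b ∣                                  ≡⟨ cong (λ a → ∣ a - b ∣) (hᵥ-negate bottom x) ⟨
    ∣ hᵥ top x - b ∣                             ∎
    where
    open Relation.Binary.PropositionalEquality.≡-Reasoning
    b : ℤ
    b = hᵥ bottom x
    lemma : ∀ a b → (a - b) + (- a - b) ≡ - b - b
    lemma = solve-∀

  half-excess-negate : ∀ B x → ℕ.⌊ excess B x /2⌋ ℕ.+ ℕ.⌊ excess (negate B) x /2⌋ ≡ ℕ.⌊ excess top x /2⌋
  half-excess-negate B x = trans
    (sym (⌊m+n/2⌋≡⌊m/2⌋+⌊n/2⌋ (excess (negate B) x) (∣i∣-even (bottom≤hᵥ B x) (hᵥ-parity bottom B x))))
    (cong ℕ.⌊_/2⌋ (excess-negate B x))

  rank-negate : ∀ B → rank (negate B) ≡ rank top ℕ.∸ rank B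
  rank-negate B = trans (sym (ℕ.m+n∸m≡n (rank B) (rank (negate B)))) (cong (ℕ._∸ rank B) sum-negate)
    where
    sum-negate : rank B ℕ.+ rank (negate B) ≡ rank top
    sum-negate = trans (sym (∑-distrib-+ (λ x → ℕ.⌊ excess B x /2⌋) (λ x → ℕ.⌊ excess (negate B) x /2⌋)))
                       (sum-cong-≗ (half-excess-negate B))

  raisableBelow⇒rank< : ∀ {B C} → RaisableBelow B C → rank B ℕ.< rank C
  raisableBelow⇒rank< {B} {C} (w , w≢v , src , raised⊑C) =
    subst (ℕ._≤ rank C) (rank-raise B w src w≢v) (rank-mono {raise B w src} {C} raised⊑C)

  rank-strict : ∀ {B C} → B ⊑ C → ¬ B ≈ C → rank B ℕ.< rank C
  rank-strict {B} {C} B⊑C B≉C = raisableBelow⇒rank< {B} {C} (raisableBelow {B} {C} B⊑C B≉C)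

  ⊑∧rank≡⇒≈ : ∀ {B C} → B ⊑ C → rank B ≡ rank C → B ≈ C
  ⊑∧rank≡⇒≈ {B} {C} B⊑C rank≡ =
    decidable-stable (B ≈? C) λ B≉C → ℕ.<⇒≢ (rank-strict {B} {C} B⊑C B≉C) rank≡

  rank≡0⇒≈bottom : ∀ B → rank B ≡ 0 → B ≈ bottom
  rank≡0⇒≈bottom B rank≡0 =
    ≈-sym {bottom} {B} (⊑∧rank≡⇒≈ {bottom} {B} (bottom-least B) (trans rank-bottom (sym rank≡0)))

  rank≡rank-top⇒≈top : ∀ B → rank B ≡ rank top → B ≈ top
  rank≡rank-top⇒≈top B = ⊑∧rank≡⇒≈ {B} {top} (top-greatest B)

  open Order _≈_ _⊑_ using (_⋖_; RankSymmetricRanked; HasCard)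

  RaisedTo : Ranking A → Ranking A → Set
  RaisedTo B C = Σ (Vertex A) λ w → w ≢ v × Σ (IsSource A (h B) w) λ src → raise B w src ≈ C

  cover⇒raisedTo : ∀ {B C} → B ⋖ C → RaisedTo B C
  cover⇒raisedTo {B} {C} (B⊑C , B≉C , between) = raisedTo (raisableBelow {B} {C} B⊑C B≉C)
    where
    raisedTo : RaisableBelow B C → RaisedTo B C
    raisedTo (w , w≢v , src , raised⊑C) with between (raise B w src) (raise-⊒ B w src w≢v) raised⊑C
    ... | inj₁ raised≈B = contradiction raised≈B (raise-≉ B w src w≢v)
    ... | inj₂ raised≈C = w , w≢v , src , raised≈C

  raisedTo⇒rank≡suc : ∀ {B C} → RaisedTo B C → rank C ≡ ℕ.suc (rank B)
  raisedTo⇒rank≡suc {B} {C} (w , w≢v , src , raised≈C) =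
    trans (sym (rank-cong {raise B w src} {C} raised≈C)) (rank-raise B w src w≢v)

  raisedTo⇒flip : ∀ {B C} → RaisedTo B C → Σ (Vertex A) λ w → w ≢ v × VertexFlip A B C w
  raisedTo⇒flip (w , w≢v , src , raised≈C) = w , w≢v , inj₁ (src , raised≈C)

  open Counting (DecSetoid.setoid rankingDecSetoid) _⊑_

  ⊑-rankSymmetricRanked : RankSymmetricRanked
  ⊑-rankSymmetricRanked =
      rank , rank top
    , (λ B C → rank-cong {B} {C})
    , (λ B → rank-mono {B} {top} (top-greatest B))
    , (λ B minimal → trans (rank-cong {B} {bottom} (≈-sym {bottom} {B} (minimal bottom (bottom-least B)))) rank-bottom)
    , (λ B maximal → rank-cong {B} {top} (≈-sym {top} {B} (maximal top (top-greatest B))))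
    , (λ B C → raisedTo⇒rank≡suc {B} {C} ∘ cover⇒raisedTo {B} {C})
    , (λ i i≤m → _ , ofRank i , ofOppositeRank i i≤m)
    , hasCard-singleton bottom rank-bottom rank≡0⇒≈bottom
    , hasCard-singleton top refl rank≡rank-top⇒≈top
    where
    ofRank : ∀ i → HasCard (λ B → rank B ≡ i) (length (filter (λ B → rank B ℕ.≟ i) allRankings))
    ofRank i = hasCard-filter (λ B → rank B ℕ.≟ i) (λ {B} {C} B≈C rank≡i → trans (sym (rank-cong {B} {C} B≈C)) rank≡i)
                 allRankings-complete allRankings-unique
    negated : ∀ i {B} → rank B ≡ i → rank (negate B) ≡ rank top ℕ.∸ i
    negated i {B} rank≡i = trans (rank-negate B) (cong (rank top ℕ.∸_) rank≡i)
    unnegated : ∀ i → i ℕ.≤ rank top → ∀ {B} → rank B ≡ rank top ℕ.∸ i → ∃ λ C → rank C ≡ i × B ≈ negate C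
    unnegated i i≤m {B} rank≡m-i = negate B
      , trans (rank-negate B) (trans (cong (rank top ℕ.∸_) rank≡m-i) (ℕ.m∸[m∸n]≡n i≤m))
      , ≈-sym {negate (negate B)} {B} (negate-involutive B)
    ofOppositeRank : ∀ i → i ℕ.≤ rank top →
                     HasCard (λ B → rank B ≡ rank top ℕ.∸ i) (length (filter (λ B → rank B ℕ.≟ i) allRankings))
    ofOppositeRank i i≤m =
      hasCard-image {P = λ B → rank B ≡ i} {Q = λ B → rank B ≡ rank top ℕ.∸ i} negate
        (λ {B} {C} → negate-cong {B} {C}) (λ {B} {C} → negate-injective {B} {C})
        (λ {B} → negated i {B}) (λ {B} → unnegated i i≤m {B}) (ofRank i)

mainTheorem5 : ∀ {n : ℕ} (A : Chromotopology n) (v : Vertex A) →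
    Σ (Rel (Ranking A) 0ℓ) λ _≤_ →
        IsPartialOrder (_≈R_ A) _≤_
      × Order.RankSymmetricRanked (_≈R_ A) _≤_
      × (∀ B C → Order._⋖_ (_≈R_ A) _≤_ B C →
           Σ (Vertex A) λ w → (w ≢ v) × VertexFlip A B C w)
mainTheorem5 A v = _⊑_ , ⊑-isPartialOrder , ⊑-rankSymmetricRanked ,
                   λ B C → raisedTo⇒flip {B} {C} ∘ cover⇒raisedTo {B} {C}
  where open Normalised A v
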